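{- Let $p$ be a prime, $r\geq 2$ an integer, and $l$ a nonnegative integer with $l<p$ that is a multiple of $r$. Then for every integer $k>1$ and every integer $h$ with $1\leq h<k$, the integer $\frac{l}{r}\sum_{i=1}^{kr}p^{kr-i}-h$ does not lie in the image of $Z_{p^r}:\mathbb{N}\to\mathbb{N}$.
   Context: For an integer $b\geq 2$, $Z_b(m)$ denotes the number of trailing zeroes in the base $b$ expansion of $m!$. In particular $Z_{p^r}(m)=\lfloor Z_p(m)/r\rfloor$ where $Z_p(m)$ is the exponent of $p$ in $m!$. -}

module Defs where

open import Data.Nat using (ℕ; zero; suc; _+_; _*_; _∸_; _^_; _!)
open import Data.Nat.DivMod using (_%_; _/_)
open import Data.Nat.Properties using (_≟_)
open import Relation.Nullary using (yes; no)

-- Number of trailing zeroes of n in base (suc (suc c)), i.e. base b = c + 2 ≥ 2,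
-- computed with fuel (the fuel n suffices because b ≥ 2 and the count is < n for n > 0).
-- Convention: the count for n = 0 is irrelevant here since m! ≥ 1.
trailingZerosFuel : ℕ → ℕ → ℕ → ℕ
trailingZerosFuel zero    c n = zero
trailingZerosFuel (suc f) c zero = zero
trailingZerosFuel (suc f) c (suc n) with (suc n) % (suc (suc c)) ≟ 0
... | yes _ = suc (trailingZerosFuel f c ((suc n) / (suc (suc c))))
... | no  _ = zero

-- trailingZeros b n : number of trailing zeroes of the base-b expansion of n (b ≥ 2 required,
-- bases 0 and 1 are mapped to 0 and never used).
trailingZeros : ℕ → ℕ → ℕ
trailingZeros (suc (suc c)) n = trailingZerosFuel n c n
trailingZeros _ n = 0

Z : ℕ → ℕ → ℕ
Z b m = trailingZeros b (m !)

sumFrom1 : ℕ → (ℕ → ℕ) → ℕ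
sumFrom1 zero    f = 0
sumFrom1 (suc n) f = sumFrom1 n f + f (suc n)

-- Let S m = Σ_{i ≤ m} v_p(i) be the exponent of p in m!, so that r·Z_{p^r}(m) ≤ S m < r·(Z_{p^r}(m) + 1),
-- and let R_K = Σ_{i=1}^{K} p^{K-i}. Since S (p M) = M + S M and the numbers p M + d with 0 < d < p
-- contribute nothing, S (l p^K) = l R_K for l < p; the last factor l p^K alone contributes K.
-- Hence S jumps over the open interval (l R_K − K, l R_K) at m = l p^K. If Z_{p^r}(m) + h = l R_K / r
-- with K = k r, then S m ≥ l R_K exceeds r·(Z_{p^r}(m) + 1), while S m ≤ l R_K − K forces k r ≤ r h,
-- which contradicts h < k.
module Submission where

open import Defs
open import Data.Nat using (ℕ; _*_; _∸_; _^_; _≤_; _<_)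
open import Data.Product using (Σ)
open import Data.Nat.Divisibility using (_∣_)
open import Data.Nat.Primality using (Prime)
open import Data.Integer using (ℤ; +_; _-_)
open import Relation.Binary.PropositionalEquality using (_≡_)
open import Relation.Nullary using (¬_)

open import Data.Nat
  using (zero; suc; _+_; _>_; _!; z≤n; s≤s; _≤′_; ≤′-refl; ≤′-step; NonZero; >-nonZero; nonTrivial⇒n>1)
open import Data.Nat.DivMod using (_%_; _/_; m*[n/m]≡n; m/n<m; m≥n⇒m/n>0)
open import Data.Nat.Divisibility
  using (_∤_; quotient; 1∣_; _∣0; ∣-trans; ∣⇒≤; >⇒∤; *-monoʳ-∣; *-cancelˡ-∣;
         m∣n⇒n≡m*quotient; m%n≡0⇒n∣m; n∣m⇒m%n≡0; ∣m+n∣m⇒∣n; m∣m*n)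
open import Data.Nat.Primality using (euclidsLemma; prime⇒nonZero; prime⇒nonTrivial)
open import Data.Nat.Properties
open import Algebra.Properties.CommutativeSemigroup *-commutativeSemigroup using (interchange; x∙yz≈y∙xz; x∙yz≈yx∙z)
open import Data.Product using (_×_; _,_; proj₁; proj₂)
open import Data.Sum using ([_,_]′)
open import Function using (_∘_)
open import Relation.Binary.PropositionalEquality
  using (_≢_; refl; sym; trans; cong; cong₂; subst; subst₂; module ≡-Reasoning)
open import Relation.Nullary using (yes; no; contradiction)
import Data.Integer as ℤ
import Data.Integer.Properties as ℤₚ
open import Algebra.Properties.AbelianGroup ℤₚ.+-0-abelianGroup using (//-rightDividesˡ)

private
  variable
    p a b c h l m n r x y K M : ℕ

+m≡+n-+o⇒m+o≡n : + m ≡ + n - + c → m + c ≡ n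
+m≡+n-+o⇒m+o≡n {m} {n} {c} eq = ℤₚ.+-injective (trans (ℤₚ.pos-+ m c)
  (trans (cong (ℤ._+ + c) eq) (//-rightDividesˡ (+ c) (+ n))))

sumFrom1-cong : ∀ n {f g : ℕ → ℕ} → (∀ {i} → i ≤ n → f i ≡ g i) → sumFrom1 n f ≡ sumFrom1 n g
sumFrom1-cong zero    f≗g = refl
sumFrom1-cong (suc n) f≗g = cong₂ _+_ (sumFrom1-cong n (f≗g ∘ m≤n⇒m≤1+n)) (f≗g ≤-refl)

sumFrom1-*ˡ : ∀ n a (f : ℕ → ℕ) → sumFrom1 n (λ i → a * f i) ≡ a * sumFrom1 n f
sumFrom1-*ˡ zero    a f = sym (*-zeroʳ a)
sumFrom1-*ˡ (suc n) a f =
  trans (cong (_+ a * f (suc n)) (sumFrom1-*ˡ n a f)) (sym (*-distribˡ-+ a _ _))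

sumFrom1-mono-≤ : ∀ (f : ℕ → ℕ) → m ≤ n → sumFrom1 m f ≤ sumFrom1 n f
sumFrom1-mono-≤ {m} f = mono ∘ ≤⇒≤′
  where
  mono : m ≤′ n → sumFrom1 m f ≤ sumFrom1 n f
  mono ≤′-refl        = ≤-refl
  mono (≤′-step m≤′n) = ≤-trans (mono m≤′n) (m≤m+n _ _)

sumFrom1-<-mono : ∀ (f : ℕ → ℕ) → m < n → sumFrom1 m f + f n ≤ sumFrom1 n f
sumFrom1-<-mono {n = suc n} f (s≤s m≤n) = +-monoˡ-≤ (f (suc n)) (sumFrom1-mono-≤ f m≤n)

repunit : ℕ → ℕ → ℕ
repunit p zero    = 0
repunit p (suc K) = p * repunit p K + 1

sumFrom1-powers≡repunit : ∀ p K → sumFrom1 K (λ i → p ^ (K ∸ i)) ≡ repunit p K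
sumFrom1-powers≡repunit p zero    = refl
sumFrom1-powers≡repunit p (suc K) = cong₂ _+_ shift (cong (p ^_) (n∸n≡0 K))
  where
  open ≡-Reasoning
  shift : sumFrom1 K (λ i → p ^ (suc K ∸ i)) ≡ p * repunit p K
  shift = begin
    sumFrom1 K (λ i → p ^ (suc K ∸ i)) ≡⟨ sumFrom1-cong K (cong (p ^_) ∘ +-∸-assoc 1) ⟩
    sumFrom1 K (λ i → p * p ^ (K ∸ i)) ≡⟨ sumFrom1-*ˡ K p (λ i → p ^ (K ∸ i)) ⟩
    p * sumFrom1 K (λ i → p ^ (K ∸ i)) ≡⟨ cong (p *_) (sumFrom1-powers≡repunit p K) ⟩
    p * repunit p K                    ∎

^+repunit≡repunit-suc : ∀ p K → p ^ K + repunit p K ≡ repunit p (suc K)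
^+repunit≡repunit-suc p zero    = cong (_+ 1) (sym (*-zeroʳ p))
^+repunit≡repunit-suc p (suc K) = begin
  p * p ^ K + (p * repunit p K + 1) ≡⟨ +-assoc (p * p ^ K) _ 1 ⟨
  p * p ^ K + p * repunit p K + 1   ≡⟨ cong (_+ 1) (*-distribˡ-+ p (p ^ K) _) ⟨
  p * (p ^ K + repunit p K) + 1     ≡⟨ cong (λ e → p * e + 1) (^+repunit≡repunit-suc p K) ⟩
  p * repunit p (suc K) + 1         ∎
  where open ≡-Reasoning

record ExactPower (p a x : ℕ) : Set where
  constructor exact
  field
    pᵃ∣x    : p ^ a ∣ x
    pᵃ⁺¹∤x : p ^ suc a ∤ x

^-monoʳ-∣ : ∀ p → a ≤ b → p ^ a ∣ p ^ b
^-monoʳ-∣ p z≤n       = 1∣ _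
^-monoʳ-∣ p (s≤s a≤b) = *-monoʳ-∣ p (^-monoʳ-∣ p a≤b)

exactPower-maximal : p ^ a ∣ x → ExactPower p b x → a ≤ b
exactPower-maximal {p} {a} {b = b} pᵃ∣x (exact _ pᵇ⁺¹∤x) with a ≤? b
... | yes a≤b = a≤b
... | no  a≰b = contradiction (∣-trans (^-monoʳ-∣ p (≰⇒> a≰b)) pᵃ∣x) pᵇ⁺¹∤x

exactPower⇒>0 : ExactPower p a x → x > 0
exactPower⇒>0 {x = zero}  e = contradiction (_ ∣0) (ExactPower.pᵃ⁺¹∤x e)
exactPower⇒>0 {x = suc x} e = s≤s z≤n

exactPower-unique : ExactPower p a x → ExactPower p b x → a ≡ b
exactPower-unique eₐ e_b = ≤-antisym (exactPower-maximal (pᵃ∣x eₐ) e_b) (exactPower-maximal (pᵃ∣x e_b) eₐ)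
  where open ExactPower

exactPower-zero : p ∤ x → ExactPower p 0 x
exactPower-zero {p} {x} p∤x = exact (1∣ x) (p∤x ∘ subst (_∣ x) (*-identityʳ p))

exactPower-*ˡ : .{{_ : NonZero p}} → ExactPower p a x → ExactPower p (suc a) (p * x)
exactPower-*ˡ {p} (exact pᵃ∣x pᵃ⁺¹∤x) = exact (*-monoʳ-∣ p pᵃ∣x) (pᵃ⁺¹∤x ∘ *-cancelˡ-∣ p)

exactPower-^* : .{{_ : NonZero p}} → p ∤ x → ∀ a → ExactPower p a (p ^ a * x)
exactPower-^* {p} {x} p∤x zero    = subst (ExactPower p 0) (sym (*-identityˡ x)) (exactPower-zero p∤x)
exactPower-^* {p} {x} p∤x (suc a) =
  subst (ExactPower p (suc a)) (sym (*-assoc p (p ^ a) x)) (exactPower-*ˡ (exactPower-^* p∤x a))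

exactPower⇒cofactor : ExactPower p a x → Σ ℕ λ u → x ≡ p ^ a * u × p ∤ u
exactPower⇒cofactor {p} {a} (exact pᵃ∣x pᵃ⁺¹∤x) = quotient pᵃ∣x , x≡pᵃu , p∤u
  where
  x≡pᵃu = m∣n⇒n≡m*quotient pᵃ∣x
  p∤u : p ∤ quotient pᵃ∣x
  p∤u p∣u = pᵃ⁺¹∤x (subst₂ _∣_ (*-comm (p ^ a) p) (sym x≡pᵃu) (*-monoʳ-∣ (p ^ a) p∣u))

exactPower-* : Prime p → ExactPower p a x → ExactPower p b y → ExactPower p (a + b) (x * y)
exactPower-* {p} {a} {x} {b} {y} p-prime eₓ e_y with exactPower⇒cofactor eₓ | exactPower⇒cofactor e_y
... | u , x≡pᵃu , p∤u | w , y≡pᵇw , p∤w =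
  subst (ExactPower p (a + b)) (sym xy≡pᵃ⁺ᵇuw) (exactPower-^* p∤uw (a + b))
  where
  instance _ = prime⇒nonZero p-prime
  p∤uw : p ∤ u * w
  p∤uw = [ p∤u , p∤w ]′ ∘ euclidsLemma u w p-prime
  open ≡-Reasoning
  xy≡pᵃ⁺ᵇuw : x * y ≡ p ^ (a + b) * (u * w)
  xy≡pᵃ⁺ᵇuw = begin
    x * y                   ≡⟨ cong₂ _*_ x≡pᵃu y≡pᵇw ⟩
    p ^ a * u * (p ^ b * w) ≡⟨ interchange (p ^ a) u (p ^ b) w ⟩
    p ^ a * p ^ b * (u * w) ≡⟨ cong (_* (u * w)) (^-distribˡ-+-* p a b) ⟨
    p ^ (a + b) * (u * w)   ∎

trailingZerosFuel-exactPower : ∀ f c n → 1 ≤ n → n ≤ f → ExactPower (2 + c) (trailingZerosFuel f c n) n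
trailingZerosFuel-exactPower (suc f) c (suc n) _ (s≤s n≤f) with suc n % (2 + c) ≟ 0
... | no  n%b≢0 = exactPower-zero (n%b≢0 ∘ n∣m⇒m%n≡0 (suc n) (2 + c))
... | yes n%b≡0 = subst (ExactPower (2 + c) _) b*q≡n (exactPower-*ˡ (trailingZerosFuel-exactPower f c q 1≤q q≤f))
  where
  q = suc n / (2 + c)
  b∣n : 2 + c ∣ suc n
  b∣n = m%n≡0⇒n∣m (suc n) (2 + c) n%b≡0
  b*q≡n : (2 + c) * q ≡ suc n
  b*q≡n = m*[n/m]≡n b∣n
  1≤q : 1 ≤ q
  1≤q = m≥n⇒m/n>0 (∣⇒≤ b∣n)
  q≤f : q ≤ f
  q≤f = ≤-trans (<⇒≤pred (m/n<m (suc n) (2 + c) (s≤s (s≤s z≤n)))) n≤f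

trailingZeros-exactPower : 1 < b → 1 ≤ n → ExactPower b (trailingZeros b n) n
trailingZeros-exactPower {suc (suc c)} {n} _ 1≤n = trailingZerosFuel-exactPower n c n 1≤n ≤-refl
trailingZeros-exactPower {suc zero} (s≤s ())

valuation-exactPower : Prime p → 1 ≤ x → ExactPower p (trailingZeros p x) x
valuation-exactPower {p} p-prime = trailingZeros-exactPower (nonTrivial⇒n>1 p {{prime⇒nonTrivial p-prime}})

valuation-unique : Prime p → ExactPower p a x → trailingZeros p x ≡ a
valuation-unique p-prime e = exactPower-unique (valuation-exactPower p-prime (exactPower⇒>0 e)) e

valuation-coprime : Prime p → p ∤ x → trailingZeros p x ≡ 0
valuation-coprime p-prime p∤x = valuation-unique p-prime (exactPower-zero p∤x)

valuation-p* : Prime p → 1 ≤ x → trailingZeros p (p * x) ≡ suc (trailingZeros p x)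
valuation-p* p-prime 1≤x = valuation-unique p-prime (exactPower-*ˡ (valuation-exactPower p-prime 1≤x))
  where instance _ = prime⇒nonZero p-prime

valuation-*^ : Prime p → 1 ≤ l → l < p → ∀ K → trailingZeros p (l * p ^ K) ≡ K
valuation-*^ {p} {l = suc l} p-prime _ l<p K =
  valuation-unique p-prime (subst (ExactPower p K) (*-comm (p ^ K) (suc l)) (exactPower-^* (>⇒∤ l<p) K))
  where instance _ = prime⇒nonZero p-prime

valuationSum : ℕ → ℕ → ℕ
valuationSum p m = sumFrom1 m (trailingZeros p)

valuationSum-exactPower : Prime p → ∀ m → ExactPower p (valuationSum p m) (m !)
valuationSum-exactPower {p} p-prime zero    = exactPower-zero (>⇒∤ (nonTrivial⇒n>1 p {{prime⇒nonTrivial p-prime}}))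
valuationSum-exactPower {p} p-prime (suc m) = subst (λ e → ExactPower p e (suc m !)) (+-comm (trailingZeros p (suc m)) _)
  (exactPower-* p-prime (valuation-exactPower {x = suc m} p-prime (s≤s z≤n)) (valuationSum-exactPower p-prime m))

valuationSum-block : Prime p → ∀ M d → d < p → valuationSum p (p * M + d) ≡ valuationSum p (p * M)
valuationSum-block {p} p-prime M zero    _     = cong (valuationSum p) (+-identityʳ (p * M))
valuationSum-block {p} p-prime M (suc d) 1+d<p = begin
  S (p * M + suc d)                  ≡⟨ cong S (+-suc (p * M) d) ⟩
  S (p * M + d) + v (suc (p * M + d)) ≡⟨ cong₂ _+_ (valuationSum-block p-prime M d d<p) (valuation-coprime p-prime p∤pM+1+d) ⟩
  S (p * M) + 0                      ≡⟨ +-identityʳ _ ⟩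
  S (p * M)                          ∎
  where
  open ≡-Reasoning
  S = valuationSum p
  v = trailingZeros p
  d<p = ≤-trans (n≤1+n (suc d)) 1+d<p
  p∤pM+1+d : p ∤ suc (p * M + d)
  p∤pM+1+d p∣ = >⇒∤ 1+d<p (∣m+n∣m⇒∣n (subst (p ∣_) (sym (+-suc (p * M) d)) p∣) (m∣m*n M))

valuationSum-p* : Prime p → ∀ M → valuationSum p (p * M) ≡ M + valuationSum p M
valuationSum-p* {p} p-prime zero = cong (valuationSum p) (*-zeroʳ p)
valuationSum-p* {p = p@(suc p₁)} p-prime (suc M) = begin
  S (p * suc M)                              ≡⟨ cong S p[1+M]≡1+pM+p₁ ⟩
  S (p * M + p₁) + v (suc (p * M + p₁))      ≡⟨ cong₂ _+_ (valuationSum-block p-prime M p₁ ≤-refl)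
                                                           (cong v (sym p[1+M]≡1+pM+p₁)) ⟩
  S (p * M) + v (p * suc M)                  ≡⟨ cong₂ _+_ (valuationSum-p* p-prime M) (valuation-p* p-prime (s≤s z≤n)) ⟩
  M + S M + suc (v (suc M))                  ≡⟨ +-suc (M + S M) _ ⟩
  suc (M + S M + v (suc M))                  ≡⟨ cong suc (+-assoc M (S M) _) ⟩
  suc M + (S M + v (suc M))                  ∎
  where
  open ≡-Reasoning
  S = valuationSum p
  v = trailingZeros p
  p[1+M]≡1+pM+p₁ : p * suc M ≡ suc (p * M + p₁)
  p[1+M]≡1+pM+p₁ = trans (*-suc p M) (cong suc (+-comm p₁ (p * M)))

valuationSum-*^ : Prime p → l < p → ∀ K → valuationSum p (l * p ^ K) ≡ l * repunit p K
valuationSum-*^ {p} {l} p-prime l<p zero = begin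
  S (l * 1)     ≡⟨ cong S (trans (*-identityʳ l) (cong (_+ l) (sym (*-zeroʳ p)))) ⟩
  S (p * 0 + l) ≡⟨ valuationSum-block p-prime 0 l l<p ⟩
  S (p * 0)     ≡⟨ cong S (*-zeroʳ p) ⟩
  0             ≡⟨ *-zeroʳ l ⟨
  l * 0         ∎
  where
  open ≡-Reasoning
  S = valuationSum p
valuationSum-*^ {p} {l} p-prime l<p (suc K) = begin
  S (l * (p * p ^ K))         ≡⟨ cong S (x∙yz≈y∙xz l p (p ^ K)) ⟩
  S (p * (l * p ^ K))         ≡⟨ valuationSum-p* p-prime (l * p ^ K) ⟩
  l * p ^ K + S (l * p ^ K)   ≡⟨ cong (λ e → l * p ^ K + e) (valuationSum-*^ p-prime l<p K) ⟩
  l * p ^ K + l * repunit p K ≡⟨ *-distribˡ-+ l (p ^ K) _ ⟨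
  l * (p ^ K + repunit p K)   ≡⟨ cong (l *_) (^+repunit≡repunit-suc p K) ⟩
  l * repunit p (suc K)       ∎
  where
  open ≡-Reasoning
  S = valuationSum p

valuationSum-below : Prime p → l < p → m < l * p ^ K → valuationSum p m + K ≤ l * repunit p K
valuationSum-below {p} {l = l@(suc _)} {m} {K} p-prime l<p m<lpᴷ = begin
  valuationSum p m + K                         ≡⟨ cong (λ e → valuationSum p m + e) (valuation-*^ p-prime (s≤s z≤n) l<p K) ⟨
  valuationSum p m + trailingZeros p (l * p ^ K) ≤⟨ sumFrom1-<-mono (trailingZeros p) m<lpᴷ ⟩
  valuationSum p (l * p ^ K)                   ≡⟨ valuationSum-*^ p-prime l<p K ⟩
  l * repunit p K                              ∎
  where open ≤-Reasoning

valuationSum-above : Prime p → l < p → l * p ^ K ≤ m → l * repunit p K ≤ valuationSum p m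
valuationSum-above {p} {l} {K} {m} p-prime l<p lpᴷ≤m =
  subst (_≤ valuationSum p m) (valuationSum-*^ p-prime l<p K) (sumFrom1-mono-≤ (trailingZeros p) lpᴷ≤m)

Z-prime-power-bounds : Prime p → 1 ≤ r → ∀ m →
  r * Z (p ^ r) m ≤ valuationSum p m × valuationSum p m < r * suc (Z (p ^ r) m)
Z-prime-power-bounds {p} {r} p-prime 1≤r m = lower , upper
  where
  open ExactPower
  t = Z (p ^ r) m
  tz : ExactPower (p ^ r) t (m !)
  tz = trailingZeros-exactPower (^-monoʳ-< p (nonTrivial⇒n>1 p {{prime⇒nonTrivial p-prime}}) 1≤r) (1≤n! m)
  legendre : ExactPower p (valuationSum p m) (m !)
  legendre = valuationSum-exactPower p-prime m
  lower = exactPower-maximal (subst (_∣ m !) (^-*-assoc p r t) (pᵃ∣x tz)) legendre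
  upper : valuationSum p m < r * suc t
  upper = ≰⇒> λ r[1+t]≤S → pᵃ⁺¹∤x tz
    (subst (_∣ m !) (sym (^-*-assoc p r (suc t))) (∣-trans (^-monoʳ-∣ p r[1+t]≤S) (pᵃ∣x legendre)))

Z-prime-power-gap : Prime p → l < p → 1 ≤ r → 1 ≤ h → r * h < K →
  r * (Z (p ^ r) m + h) ≢ l * repunit p K
Z-prime-power-gap {p} {l} {r} {h} {K} {m} p-prime l<p 1≤r 1≤h rh<K r[t+h]≡lR with l * p ^ K ≤? m
... | yes lpᴷ≤m = <⇒≱ upper (begin
  r * suc t      ≤⟨ *-monoʳ-≤ r (subst (_≤ t + h) (+-comm t 1) (+-monoʳ-≤ t 1≤h)) ⟩
  r * (t + h)    ≡⟨ r[t+h]≡lR ⟩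
  l * repunit p K ≤⟨ valuationSum-above {K = K} p-prime l<p lpᴷ≤m ⟩
  valuationSum p m ∎)
  where
  open ≤-Reasoning
  t = Z (p ^ r) m
  upper = proj₂ (Z-prime-power-bounds p-prime 1≤r m)
... | no  lpᴷ≰m = <⇒≱ rh<K (+-cancelˡ-≤ (r * t) K (r * h) (begin
  r * t + K            ≤⟨ +-monoˡ-≤ K lower ⟩
  valuationSum p m + K ≤⟨ valuationSum-below p-prime l<p (≰⇒> lpᴷ≰m) ⟩
  l * repunit p K      ≡⟨ r[t+h]≡lR ⟨
  r * (t + h)          ≡⟨ *-distribˡ-+ r t h ⟩
  r * t + r * h        ∎))
  where
  open ≤-Reasoning
  t = Z (p ^ r) m
  lower = proj₁ (Z-prime-power-bounds p-prime 1≤r m)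

proposition8 : (p r l : ℕ) → Prime p → 2 ≤ r → l < p → (r∣l : r ∣ l) →
    (k h : ℕ) → 1 < k → 1 ≤ h → h < k →
    ¬ (Σ ℕ λ m → + (Z (p ^ r) m) ≡ + (_∣_.quotient r∣l * sumFrom1 (k * r) (λ i → p ^ (k * r ∸ i))) - + h)
proposition8 p r l p-prime 2≤r l<p r∣l k h _ 1≤h h<k (m , Z≡qR-h) =
  Z-prime-power-gap {m = m} p-prime l<p 1≤r 1≤h rh<kr r[t+h]≡lR
  where
  open ≡-Reasoning
  1≤r = ≤-trans (n≤1+n 1) 2≤r
  instance _ = >-nonZero 1≤r
  q = quotient r∣l
  R = repunit p (k * r)
  t+h≡qR : Z (p ^ r) m + h ≡ q * R
  t+h≡qR = trans (+m≡+n-+o⇒m+o≡n Z≡qR-h) (cong (q *_) (sumFrom1-powers≡repunit p (k * r)))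
  r[t+h]≡lR : r * (Z (p ^ r) m + h) ≡ l * R
  r[t+h]≡lR = begin
    r * (Z (p ^ r) m + h) ≡⟨ cong (r *_) t+h≡qR ⟩
    r * (q * R)           ≡⟨ x∙yz≈yx∙z r q R ⟩
    q * r * R             ≡⟨ cong (_* R) (_∣_.equality r∣l) ⟨
    l * R                 ∎
  rh<kr : r * h < k * r
  rh<kr = subst (_< k * r) (*-comm h r) (*-monoˡ-< r h<k)
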